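{- Let $q\ge2$ and $n$ be positive integers with $q\mid n$. Let $\boldsymbol{r}=(r_0,r_1,\dots,r_{q-1})$ be a composition of $n$ and $\boldsymbol{r}^{(1)}=(r_1,r_2,\dots,r_{q-1},r_0)$ its left cyclic shift. Then $K^{(\mathbb{Z}_q)}_{\boldsymbol{n/q}}(\boldsymbol{r}^{(1)})=(-1)^{\frac{(q-1)n}{q}}K^{(\mathbb{Z}_q)}_{\boldsymbol{n/q}}(\boldsymbol{r})$.
   Context: For $x\in\mathbb{Z}_q^n$, $\operatorname{comp}(x)=(r_0,\dots,r_{q-1})$ where $r_g$ is the number of coordinates of $x$ equal to $g$. Let $S_{\boldsymbol{n/q}}=\{x\in\mathbb{Z}_q^n:\operatorname{comp}(x)=(n/q,\dots,n/q)\}$ and $\zeta_q=e^{2\pi i/q}$. For a composition $\boldsymbol r$ of $n$, $K^{(\mathbb{Z}_q)}_{\boldsymbol{n/q}}(\boldsymbol{r})=\sum_{y\in S_{\boldsymbol{n/q}}}\zeta_q^{a\cdot y}$ for any $a\in\mathbb{Z}_q^n$ with $\operatorname{comp}(a)=\boldsymbol{r}$, where $a\cdot y=\sum_k a_ky_k$; equivalently it is the coefficient of $\prod_g z_g^{n/q}$ in $\prod_{h\in\mathbb{Z}_q}\big(\sum_{g\in\mathbb{Z}_q}\zeta_q^{hg}z_g\big)^{r_h}$. -}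

module Defs where

open import Level using (Level)
open import Data.Nat using (ℕ; zero; suc; _+_; _*_; _<_)
open import Data.Fin using (Fin; toℕ)
open import Data.Fin.Properties using () renaming (_≟_ to _≟ᶠ_)
open import Data.Vec using (Vec; []; _∷_; _∷ʳ_; tabulate; count; foldr)
open import Data.Vec.Properties using (≡-dec)
open import Data.List using (List; []; _∷_; map; concatMap; filter; allFin)
import Data.List
import Data.Nat.Properties as ℕP
open import Relation.Nullary using (¬_)
open import Relation.Binary.PropositionalEquality using (_≡_)
open import Data.Sum using (_⊎_)
open import Data.Product using (_×_)
open import Algebra.Bundles using (CommutativeRing)
import Algebra.Definitions.RawSemiring as RS
import Algebra.Bundles

-- ℤ_q is represented by Fin q (elements 0,…,q-1).

comp : ∀ {q n} → Vec (Fin q) n → Vec ℕ q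
comp x = tabulate (λ g → count (λ h → h ≟ᶠ g) x)

rotate : ∀ {a} {A : Set a} {q} → Vec A q → Vec A q
rotate []       = []
rotate (x ∷ xs) = xs ∷ʳ x

allVecs : ∀ q n → List (Vec (Fin q) n)
allVecs q zero    = [] ∷ []
allVecs q (suc n) = concatMap (λ v → map (λ g → g ∷ v) (allFin q)) (allVecs q n)

-- S_{n/q} = { y ∈ ℤ_q^n : comp(y) = (n/q,…,n/q) }, given m = n/q (i.e. n = q*m)
balanced : ∀ q m → List (Vec (Fin q) (q * m))
balanced q m = filter (λ y → ≡-dec ℕP._≟_ (comp y) (tabulate (λ _ → m))) (allVecs q (q * m))

-- a·y = Σ_k a_k y_k, computed in ℕ (only its class mod q matters since ζ^q = 1)
dot : ∀ {q n} → Vec (Fin q) n → Vec (Fin q) n → ℕ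
dot []       []       = 0
dot (a ∷ as) (y ∷ ys) = toℕ a * toℕ y + dot as ys

module _ {c ℓ : Level} (R : CommutativeRing c ℓ) where
  open CommutativeRing R renaming (_+_ to _+ᴿ_; _*_ to _*ᴿ_)
  open RS (Algebra.Bundles.Semiring.rawSemiring semiring) using (_^_)

  NoZeroDivisors : Set (c Level.⊔ ℓ)
  NoZeroDivisors = ∀ x y → x *ᴿ y ≈ 0# → x ≈ 0# ⊎ y ≈ 0#

  PrimitiveRoot : ℕ → Carrier → Set ℓ
  PrimitiveRoot q ζ = (ζ ^ q ≈ 1#) × (∀ k → 0 < k → k < q → ¬ (ζ ^ k ≈ 1#))

  sumR : List Carrier → Carrier
  sumR = Data.List.foldr _+ᴿ_ 0#

  -- K_{n/q}(comp a) = Σ_{y ∈ S_{n/q}} ζ^{a·y}, where n = q*m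
  K : (ζ : Carrier) (q m : ℕ) → Vec (Fin q) (q * m) → Carrier
  K ζ q m a = sumR (map (λ y → ζ ^ dot a y) (balanced q m))

  sign : ℕ → Carrier
  sign k = (- 1#) ^ k

-- K is unchanged when the coordinates of a are permuted, because y ↦ σy permutes S_{n/q} and (σa)·(σy) = a·y.
-- Lowering every entry of a by one (mod q) gives a vector of composition r⁽¹⁾, hence a permutation of a′. For
-- y ∈ S_{n/q} this lowers a·y by Σ_k y_k = (n/q)(0+1+⋯+(q-1)) modulo q, and ζ^{0+1+⋯+(q-1)} = (-1)^{q-1}: for odd q
-- the exponent is a multiple of q, for even q it is (q/2)(q-1) and ζ^{q/2} = -1 since ζ^{q/2} squares to 1 but is
-- not 1. So K(r) = (-1)^{(q-1)n/q} K(r⁽¹⁾), and the sign is its own inverse.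

module Submission where

open import Defs
open import Level using (Level)
open import Algebra.Bundles using (CommutativeRing; Semiring)
import Algebra.Definitions.RawSemiring as RawSemiringDefinitions
import Algebra.Properties.CommutativeSemigroup as CommutativeSemigroupProperties
import Algebra.Properties.CommutativeSemiring.Exp as CommutativeSemiringExp
import Algebra.Properties.Ring as RingProperties
import Algebra.Properties.Semiring.Exp as SemiringExp
open import Data.Bool.Base using (true; false; if_then_else_)
open import Data.Empty using (⊥-elim)
open import Data.Fin.Base using (Fin; zero; suc; toℕ; fromℕ; inject₁; lower₁)
open import Data.Fin.Properties
  using (_≟_; toℕ-injective; toℕ-fromℕ; toℕ-inject₁; fromℕ≢inject₁; inject₁-injective; inject₁-lower₁)
open import Data.List.Base as List using (List; []; _∷_; _++_; concatMap; filter; allFin)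
open import Data.List.Properties using (map-∘)
open import Data.List.Relation.Unary.All as All using (All; []; _∷_)
open import Data.List.Relation.Unary.All.Properties using (all-filter)
open import Data.Nat.Base using (ℕ; zero; suc; _+_; _*_; _∸_; _≤_; _<_; z<s)
import Data.Nat.Properties as ℕ
open import Data.Nat.Tactic.RingSolver using (solve-∀)
open import Data.Product.Base using (∃; _,_; proj₁)
open import Data.Sum.Base using (_⊎_; inj₁; inj₂)
open import Data.Vec.Base as Vec using (Vec; []; _∷_; _∷ʳ_; lookup; tabulate; count)
open import Data.Vec.Properties using (≡-dec; lookup∘tabulate; tabulate-cong)
open import Function.Base using (_∘_; id; _on_)
open import Function.Definitions using (Injective)
open import Relation.Binary.Core using (Rel; _Preserves_⟶_)
open import Relation.Binary.Definitions using (Reflexive; Transitive)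
open import Relation.Binary.Construct.Closure.ReflexiveTransitive
  using (Star; ε; _◅_; _◅◅_; gmap; fold)
open import Relation.Binary.PropositionalEquality
  using (_≡_; refl; sym; trans; cong; cong₂; subst; module ≡-Reasoning)
open import Relation.Nullary.Decidable using (yes; no; does; dec-true)
open import Relation.Unary using (Pred; Decidable)

open import Algebra.Properties.Semiring.Sum ℕ.+-*-semiring
  using (sum-syntax; sum-cong-≗; sum-init-last; sum-replicate-zero; ∑-distrib-+; *-distribʳ-sum)
open CommutativeSemigroupProperties ℕ.+-commutativeSemigroup using (x∙yz≈y∙xz)

private
  variable
    a b : Level
    A : Set a
    B : Set b
    m n p q : ℕ

-- Adjacent transpositions of vector entries

swapAt : Fin n → Vec A (suc n) → Vec A (suc n)
swapAt zero    (x ∷ y ∷ v) = y ∷ x ∷ v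
swapAt (suc i) (x ∷ v)     = x ∷ swapAt i v

data Swapped {A : Set a} : ∀ {n} → Rel (Vec A n) a where
  swapped : ∀ {n} (i : Fin n) (v : Vec A (suc n)) → Swapped v (swapAt i v)

infix 4 _↭_

_↭_ : Rel (Vec A n) _
_↭_ = Star Swapped

↭-∷ : ∀ x {v w : Vec A n} → v ↭ w → (x ∷ v) ↭ (x ∷ w)
↭-∷ x = gmap (x ∷_) λ { (swapped i v) → swapped (suc i) (x ∷ v) }

↭-preserves : ∀ {ℓ} {_≈_ : Rel B ℓ} (f : Vec A n → B) → Reflexive _≈_ → Transitive _≈_ →
              f Preserves Swapped ⟶ _≈_ → f Preserves _↭_ ⟶ _≈_
↭-preserves {_≈_ = _≈_} f ≈-refl ≈-trans step = fold (_≈_ on f) (λ s → ≈-trans (step s)) ≈-refl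

occurrences : Fin q → Vec (Fin q) n → ℕ
occurrences g = count (_≟ g)

occurrences-∷-self : ∀ (g : Fin q) (v : Vec (Fin q) n) → occurrences g (g ∷ v) ≡ suc (occurrences g v)
occurrences-∷-self g v rewrite dec-true (g ≟ g) refl = refl

occurrences-∷-cancel : ∀ (g h : Fin q) {v w : Vec (Fin q) n} →
                       occurrences g (h ∷ v) ≡ occurrences g (h ∷ w) → occurrences g v ≡ occurrences g w
occurrences-∷-cancel g h eq with does (h ≟ g)
... | true  = ℕ.suc-injective eq
... | false = eq

occurrences-swapAt : ∀ (g : Fin q) (i : Fin n) v → occurrences g (swapAt i v) ≡ occurrences g v
occurrences-swapAt g zero (x ∷ y ∷ v) with does (x ≟ g) | does (y ≟ g)
... | true  | true  = refl
... | true  | false = refl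
... | false | true  = refl
... | false | false = refl
occurrences-swapAt g (suc i) (x ∷ v) =
  cong (if does (x ≟ g) then suc else id) (occurrences-swapAt g i v)

occurrences-map-injective : ∀ {f : Fin p → Fin q} → Injective _≡_ _≡_ f →
                            ∀ g (v : Vec (Fin p) n) → occurrences (f g) (Vec.map f v) ≡ occurrences g v
occurrences-map-injective         f-inj g []      = refl
occurrences-map-injective {f = f} f-inj g (h ∷ v) with h ≟ g | f h ≟ f g
... | yes _   | yes _     = cong suc (occurrences-map-injective f-inj g v)
... | yes h≡g | no fh≢fg  = ⊥-elim (fh≢fg (cong f h≡g))
... | no h≢g  | yes fh≡fg = ⊥-elim (h≢g (f-inj fh≡fg))
... | no _    | no _      = occurrences-map-injective f-inj g v

comp-swapAt : ∀ (i : Fin n) (v : Vec (Fin q) (suc n)) → comp (swapAt i v) ≡ comp v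
comp-swapAt i v = tabulate-cong λ g → occurrences-swapAt g i v

↭-occurrences : ∀ (g : Fin q) {v w : Vec (Fin q) n} → v ↭ w → occurrences g v ≡ occurrences g w
↭-occurrences g = ↭-preserves {_≈_ = _≡_} (occurrences g) refl trans λ where
  (swapped i v) → sym (occurrences-swapAt g i v)

↭-toFront : ∀ (g : Fin q) (v : Vec (Fin q) (suc n)) → 0 < occurrences g v → ∃ λ w → (g ∷ w) ↭ v
↭-toFront g (x ∷ v) g∈xv with x ≟ g | v
... | yes refl | w     = w , ε
... | no _     | []    = ⊥-elim (ℕ.n≮0 g∈xv)
... | no _     | y ∷ w with w′ , gw′↭yw ← ↭-toFront g (y ∷ w) g∈xv =
  x ∷ w′ , swapped zero (g ∷ x ∷ w′) ◅ ↭-∷ x gw′↭yw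

occurrences-≗⇒↭ : ∀ (v w : Vec (Fin q) n) → (∀ g → occurrences g v ≡ occurrences g w) → v ↭ w
occurrences-≗⇒↭ []      []  _    = ε
occurrences-≗⇒↭ (x ∷ v) w   same
  with w′ , xw′↭w ← ↭-toFront x w (subst (0 <_) (trans (sym (occurrences-∷-self x v)) (same x)) z<s) =
  ↭-∷ x (occurrences-≗⇒↭ v w′ λ g →
    occurrences-∷-cancel g x {v} {w′} (trans (same g) (sym (↭-occurrences g xw′↭w)))) ◅◅ xw′↭w

-- The cyclic predecessor g ↦ g - 1 on ℤ_q

cyclicPred : Fin (suc p) → Fin (suc p)
cyclicPred {p} zero = fromℕ p
cyclicPred (suc i)  = inject₁ i

cyclicPred-injective : Injective _≡_ _≡_ (cyclicPred {p})
cyclicPred-injective {x = zero}  {zero}  _  = refl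
cyclicPred-injective {x = zero}  {suc j} eq = ⊥-elim (fromℕ≢inject₁ eq)
cyclicPred-injective {x = suc i} {zero}  eq = ⊥-elim (fromℕ≢inject₁ (sym eq))
cyclicPred-injective {x = suc i} {suc j} eq = cong suc (inject₁-injective eq)

cyclicPred-surjective : ∀ (k : Fin (suc p)) → ∃ λ g → cyclicPred g ≡ k
cyclicPred-surjective {p} k with p ℕ.≟ toℕ k
... | yes p≡k = zero , toℕ-injective (trans (toℕ-fromℕ p) p≡k)
... | no p≢k  = suc (lower₁ k p≢k) , inject₁-lower₁ k p≢k

toℕ-cyclicPred : ∀ (g : Fin (suc p)) → ∃ λ e → suc (toℕ (cyclicPred g)) ≡ toℕ g + suc p * e
toℕ-cyclicPred {p} zero    = 1 , trans (cong suc (toℕ-fromℕ p)) (sym (ℕ.*-identityʳ (suc p)))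
toℕ-cyclicPred {p} (suc i) = 0 , (begin
  suc (toℕ (inject₁ i))  ≡⟨ cong suc (toℕ-inject₁ i) ⟩
  suc (toℕ i)            ≡⟨ ℕ.+-identityʳ _ ⟨
  suc (toℕ i) + 0        ≡⟨ cong (suc (toℕ i) +_) (ℕ.*-zeroʳ (suc p)) ⟨
  suc (toℕ i) + suc p * 0 ∎)
  where open ≡-Reasoning

lookup-∷ʳ-fromℕ : ∀ (v : Vec A p) x → lookup (v ∷ʳ x) (fromℕ p) ≡ x
lookup-∷ʳ-fromℕ []      x = refl
lookup-∷ʳ-fromℕ (y ∷ v) x = lookup-∷ʳ-fromℕ v x

lookup-∷ʳ-inject₁ : ∀ (v : Vec A p) x i → lookup (v ∷ʳ x) (inject₁ i) ≡ lookup v i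
lookup-∷ʳ-inject₁ (y ∷ v) x zero    = refl
lookup-∷ʳ-inject₁ (y ∷ v) x (suc i) = lookup-∷ʳ-inject₁ v x i

lookup-rotate-cyclicPred : ∀ (v : Vec A (suc p)) g → lookup (rotate v) (cyclicPred g) ≡ lookup v g
lookup-rotate-cyclicPred (x ∷ v) zero    = lookup-∷ʳ-fromℕ v x
lookup-rotate-cyclicPred (x ∷ v) (suc i) = lookup-∷ʳ-inject₁ v x i

-- The entry of r⁽¹⁾ at g - 1 is r_g.
rotate-comp⇒↭ : ∀ (a a′ : Vec (Fin (suc p)) n) → comp a′ ≡ rotate (comp a) → Vec.map cyclicPred a ↭ a′
rotate-comp⇒↭ a a′ eq = occurrences-≗⇒↭ _ a′ λ k → same (cyclicPred-surjective k)
  where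
  open ≡-Reasoning
  same : ∀ {k} → (∃ λ g → cyclicPred g ≡ k) → occurrences k (Vec.map cyclicPred a) ≡ occurrences k a′
  same (g , refl) = begin
    occurrences (cyclicPred g) (Vec.map cyclicPred a) ≡⟨ occurrences-map-injective cyclicPred-injective g a ⟩
    occurrences g a                                    ≡⟨ lookup∘tabulate (λ h → occurrences h a) g ⟨
    lookup (comp a) g                                  ≡⟨ lookup-rotate-cyclicPred (comp a) g ⟨
    lookup (rotate (comp a)) (cyclicPred g)            ≡⟨ cong (λ r → lookup r (cyclicPred g)) eq ⟨
    lookup (comp a′) (cyclicPred g)                    ≡⟨ lookup∘tabulate (λ h → occurrences h a′) (cyclicPred g) ⟩
    occurrences (cyclicPred g) a′                      ∎

dot-swapAt : ∀ (i : Fin n) (a y : Vec (Fin q) (suc n)) → dot (swapAt i a) y ≡ dot a (swapAt i y)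
dot-swapAt zero    (a₀ ∷ a₁ ∷ a) (y₀ ∷ y₁ ∷ y) = x∙yz≈y∙xz (toℕ a₁ * toℕ y₀) (toℕ a₀ * toℕ y₁) (dot a y)
dot-swapAt (suc i) (a₀ ∷ a)      (y₀ ∷ y)      = cong (toℕ a₀ * toℕ y₀ +_) (dot-swapAt i a y)

+-*-congruence-step : ∀ q d g y D S A e₁ e₂ → suc d ≡ g + q * e₁ → D + S ≡ A + q * e₂ →
                      (d * y + D) + (y + S) ≡ (g * y + A) + q * (y * e₁ + e₂)
+-*-congruence-step q d g y D S A e₁ e₂ eq₁ eq₂ = begin
  (d * y + D) + (y + S)              ≡⟨ regroup d y D S ⟩
  suc d * y + (D + S)                ≡⟨ cong₂ (λ u v → u * y + v) eq₁ eq₂ ⟩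
  (g + q * e₁) * y + (A + q * e₂)    ≡⟨ expand q g y A e₁ e₂ ⟩
  (g * y + A) + q * (y * e₁ + e₂)    ∎
  where
  open ≡-Reasoning
  regroup : ∀ d y D S → (d * y + D) + (y + S) ≡ suc d * y + (D + S)
  regroup = solve-∀
  expand : ∀ q g y A e₁ e₂ → (g + q * e₁) * y + (A + q * e₂) ≡ (g * y + A) + q * (y * e₁ + e₂)
  expand = solve-∀

dot-map-cyclicPred : ∀ (a y : Vec (Fin (suc p)) n) →
                     ∃ λ e → dot (Vec.map cyclicPred a) y + Vec.sum (Vec.map toℕ y) ≡ dot a y + suc p * e
dot-map-cyclicPred {p} [] [] = 0 , sym (ℕ.*-zeroʳ (suc p))
dot-map-cyclicPred {p} (g ∷ a) (h ∷ y)
  with e₁ , eq₁ ← toℕ-cyclicPred g | e₂ , eq₂ ← dot-map-cyclicPred a y =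
  toℕ h * e₁ + e₂ , +-*-congruence-step (suc p) _ (toℕ g) (toℕ h) _ _ _ e₁ e₂ eq₁ eq₂

-- The sum of the entries of a vector with composition (m,…,m)

triangle : ℕ → ℕ
triangle q = ∑[ g < q ] toℕ g

triangle-suc : ∀ p → triangle (suc p) ≡ triangle p + p
triangle-suc p = trans (sum-init-last (toℕ {suc p})) (cong₂ _+_ (sum-cong-≗ {p} toℕ-inject₁) (toℕ-fromℕ p))

triangle-odd  : ∀ k → triangle (suc (k + k)) ≡ suc (k + k) * k
triangle-even : ∀ k → triangle (suc k + suc k) ≡ suc k * suc (k + k)
triangle-odd zero    = refl
triangle-odd (suc k) = begin
  triangle (suc (suc k + suc k))              ≡⟨ triangle-suc (suc k + suc k) ⟩
  triangle (suc k + suc k) + (suc k + suc k)  ≡⟨ cong (_+ (suc k + suc k)) (triangle-even k) ⟩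
  suc k * suc (k + k) + (suc k + suc k)       ≡⟨ regroup k ⟩
  suc (suc k + suc k) * suc k                 ∎
  where
  open ≡-Reasoning
  regroup : ∀ k → suc k * suc (k + k) + (suc k + suc k) ≡ suc (suc k + suc k) * suc k
  regroup = solve-∀
triangle-even k = begin
  triangle (suc k + suc k)              ≡⟨ cong (triangle ∘ suc) (ℕ.+-suc k k) ⟩
  triangle (suc (suc (k + k)))          ≡⟨ triangle-suc (suc (k + k)) ⟩
  triangle (suc (k + k)) + suc (k + k)  ≡⟨ cong (_+ suc (k + k)) (triangle-odd k) ⟩
  suc (k + k) * k + suc (k + k)         ≡⟨ regroup k ⟩
  suc k * suc (k + k)                   ∎
  where
  open ≡-Reasoning
  regroup : ∀ k → suc (k + k) * k + suc (k + k) ≡ suc k * suc (k + k)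
  regroup = solve-∀

∑-indicator : ∀ (f : Fin q → ℕ) h → ∑[ g < q ] (if does (h ≟ g) then f g else 0) ≡ f h
∑-indicator {suc q} f zero    = trans (cong (f zero +_) (sum-replicate-zero q)) (ℕ.+-identityʳ (f zero))
∑-indicator {suc q} f (suc h) = ∑-indicator (f ∘ suc) h

*-occurrences-∷ : ∀ t (g h : Fin q) (y : Vec (Fin q) n) →
                  t * occurrences g (h ∷ y) ≡ (if does (h ≟ g) then t else 0) + t * occurrences g y
*-occurrences-∷ t g h y with does (h ≟ g)
... | true  = ℕ.*-suc t _
... | false = refl

sum-toℕ≡∑occurrences : ∀ (y : Vec (Fin q) n) → Vec.sum (Vec.map toℕ y) ≡ ∑[ g < q ] (toℕ g * occurrences g y)
sum-toℕ≡∑occurrences {q} [] = sym (trans (sum-cong-≗ {q} λ g → ℕ.*-zeroʳ (toℕ g)) (sum-replicate-zero q))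
sum-toℕ≡∑occurrences {q} (h ∷ y) = begin
  toℕ h + Vec.sum (Vec.map toℕ y)
    ≡⟨ cong₂ _+_ (∑-indicator toℕ h) (sym (sum-toℕ≡∑occurrences y)) ⟨
  ∑[ g < q ] (if does (h ≟ g) then toℕ g else 0) + ∑[ g < q ] (toℕ g * occurrences g y)
    ≡⟨ ∑-distrib-+ {q} _ _ ⟨
  ∑[ g < q ] ((if does (h ≟ g) then toℕ g else 0) + toℕ g * occurrences g y)
    ≡⟨ sum-cong-≗ {q} (λ g → *-occurrences-∷ (toℕ g) g h y) ⟨
  ∑[ g < q ] (toℕ g * occurrences g (h ∷ y)) ∎
  where open ≡-Reasoning

sum-toℕ-balanced : ∀ (y : Vec (Fin q) n) → comp y ≡ tabulate (λ _ → m) →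
                   Vec.sum (Vec.map toℕ y) ≡ triangle q * m
sum-toℕ-balanced {q} {m = m} y balanced = begin
  Vec.sum (Vec.map toℕ y)               ≡⟨ sum-toℕ≡∑occurrences y ⟩
  ∑[ g < q ] (toℕ g * occurrences g y)  ≡⟨ sum-cong-≗ {q} (λ g → cong (toℕ g *_) (occurrences≡m g)) ⟩
  ∑[ g < q ] (toℕ g * m)                ≡⟨ *-distribʳ-sum m (toℕ {q}) ⟨
  triangle q * m                        ∎
  where
  open ≡-Reasoning
  occurrences≡m : ∀ g → occurrences g y ≡ m
  occurrences≡m g = trans (sym (lookup∘tabulate _ g))
                      (trans (cong (λ r → lookup r g) balanced) (lookup∘tabulate _ g))

data Parity : ℕ → Set where
  even : ∀ k → Parity (k + k)
  odd  : ∀ k → Parity (suc (k + k))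

parity : ∀ n → Parity n
parity zero = even 0
parity (suc n) with parity n
... | even k = odd k
... | odd k  = subst Parity (cong suc (ℕ.+-suc k k)) (even (suc k))

-- Sums and powers in a commutative ring

module _ {c ℓ} (R : CommutativeRing c ℓ) where

  open CommutativeRing R
    hiding (zero)
    renaming (_+_ to _+ᴿ_; _*_ to _*ᴿ_; refl to ≈-refl; sym to ≈-sym; trans to ≈-trans)
  open RawSemiringDefinitions (Semiring.rawSemiring semiring) using (_^_)
  open SemiringExp semiring using (^-homo-*; ^-assocʳ; ^-congˡ)
  open CommutativeSemiringExp commutativeSemiring using (^-distrib-*)
  open RingProperties ring using (-1*x≈-x; -‿involutive; +-inverseˡ-unique)
  open CommutativeSemigroupProperties +-commutativeSemigroup using (interchange)
  open import Relation.Binary.Reasoning.Setoid setoid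

  1^n≈1 : ∀ n → 1# ^ n ≈ 1#
  1^n≈1 zero    = ≈-refl
  1^n≈1 (suc n) = ≈-trans (*-identityˡ _) (1^n≈1 n)

  ^-periodic : ∀ {x} q → x ^ q ≈ 1# → ∀ n e → x ^ (n + q * e) ≈ x ^ n
  ^-periodic {x} q xᵠ≈1 n e = begin
    x ^ (n + q * e)       ≈⟨ ^-homo-* x n (q * e) ⟩
    x ^ n *ᴿ x ^ (q * e)  ≈⟨ *-congˡ (^-assocʳ x q e) ⟨
    x ^ n *ᴿ (x ^ q) ^ e  ≈⟨ *-congˡ (≈-trans (^-congˡ e xᵠ≈1) (1^n≈1 e)) ⟩
    x ^ n *ᴿ 1#           ≈⟨ *-identityʳ _ ⟩
    x ^ n                 ∎

  sign-*-self : ∀ k → sign R k *ᴿ sign R k ≈ 1#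
  sign-*-self k = begin
    (- 1#) ^ k *ᴿ (- 1#) ^ k  ≈⟨ ^-distrib-* (- 1#) (- 1#) k ⟨
    (- 1# *ᴿ - 1#) ^ k        ≈⟨ ^-congˡ k (≈-trans (-1*x≈-x (- 1#)) (-‿involutive 1#)) ⟩
    1# ^ k                   ≈⟨ 1^n≈1 k ⟩
    1#                       ∎

  sign-+-self : ∀ k → sign R (k + k) ≈ 1#
  sign-+-self k = ≈-trans (^-homo-* (- 1#) k k) (sign-*-self k)

  x*x≈1⇒x≈±1 : NoZeroDivisors R → ∀ x → x *ᴿ x ≈ 1# → x ≈ 1# ⊎ x ≈ - 1#
  x*x≈1⇒x≈±1 nzd x x²≈1 with nzd (x +ᴿ - 1#) (x +ᴿ 1#) factorised
    where
    factorised : (x +ᴿ - 1#) *ᴿ (x +ᴿ 1#) ≈ 0#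
    factorised = begin
      (x +ᴿ - 1#) *ᴿ (x +ᴿ 1#)                  ≈⟨ distribʳ (x +ᴿ 1#) x (- 1#) ⟩
      x *ᴿ (x +ᴿ 1#) +ᴿ - 1# *ᴿ (x +ᴿ 1#)       ≈⟨ +-cong (distribˡ x x 1#) (-1*x≈-x (x +ᴿ 1#)) ⟩
      (x *ᴿ x +ᴿ x *ᴿ 1#) +ᴿ - (x +ᴿ 1#)        ≈⟨ +-congʳ (+-cong x²≈1 (*-identityʳ x)) ⟩
      (1# +ᴿ x) +ᴿ - (x +ᴿ 1#)                  ≈⟨ +-congʳ (+-comm 1# x) ⟩
      (x +ᴿ 1#) +ᴿ - (x +ᴿ 1#)                  ≈⟨ -‿inverseʳ (x +ᴿ 1#) ⟩
      0#                                        ∎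
  ... | inj₁ x-1≈0 = inj₁ (≈-trans (+-inverseˡ-unique x (- 1#) x-1≈0) (-‿involutive 1#))
  ... | inj₂ x+1≈0 = inj₂ (+-inverseˡ-unique x 1# x+1≈0)

  primitiveRoot-half : NoZeroDivisors R → ∀ {ζ} k → PrimitiveRoot R (suc k + suc k) ζ → ζ ^ suc k ≈ - 1#
  primitiveRoot-half nzd {ζ} k (ζᵠ≈1 , minimal)
    with x*x≈1⇒x≈±1 nzd (ζ ^ suc k) (≈-trans (≈-sym (^-homo-* ζ (suc k) (suc k))) ζᵠ≈1)
  ... | inj₁ ≈1  = ⊥-elim (minimal (suc k) z<s (ℕ.m<m+n (suc k) z<s) ≈1)
  ... | inj₂ ≈-1 = ≈-1

  primitiveRoot-^triangle : NoZeroDivisors R → ∀ {ζ} q → PrimitiveRoot R q ζ → ζ ^ triangle q ≈ sign R (q ∸ 1)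
  primitiveRoot-^triangle nzd {ζ} q root with parity q
  ... | even zero    = ≈-refl
  ... | even (suc k) = begin
    ζ ^ triangle (suc k + suc k)  ≡⟨ cong (ζ ^_) (triangle-even k) ⟩
    ζ ^ (suc k * suc (k + k))     ≈⟨ ^-assocʳ ζ (suc k) (suc (k + k)) ⟨
    (ζ ^ suc k) ^ suc (k + k)     ≈⟨ ^-congˡ (suc (k + k)) (primitiveRoot-half nzd k root) ⟩
    (- 1#) ^ suc (k + k)          ≡⟨ cong ((- 1#) ^_) (ℕ.+-suc k k) ⟨
    sign R (k + suc k)            ∎
  ... | odd k = begin
    ζ ^ triangle (suc (k + k))    ≡⟨ cong (ζ ^_) (triangle-odd k) ⟩
    ζ ^ (suc (k + k) * k)         ≈⟨ ^-periodic (suc (k + k)) (proj₁ root) 0 k ⟩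
    1#                            ≈⟨ sign-+-self k ⟨
    sign R (k + k)                ∎

  sumMap : (A → Carrier) → List A → Carrier
  sumMap f xs = sumR R (List.map f xs)

  sumMap-cong : ∀ {f g : A → Carrier} {xs} → All (λ x → f x ≈ g x) xs → sumMap f xs ≈ sumMap g xs
  sumMap-cong []          = ≈-refl
  sumMap-cong (fx≈gx ∷ p) = +-cong fx≈gx (sumMap-cong p)

  sumMap-cong-≗ : ∀ {f g : A → Carrier} xs → (∀ x → f x ≈ g x) → sumMap f xs ≈ sumMap g xs
  sumMap-cong-≗ xs f≈g = sumMap-cong (All.universal f≈g xs)

  sumMap-*ʳ : ∀ (f : A → Carrier) x xs → sumMap (λ y → f y *ᴿ x) xs ≈ sumMap f xs *ᴿ x
  sumMap-*ʳ f x []       = ≈-sym (zeroˡ x)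
  sumMap-*ʳ f x (y ∷ xs) = ≈-trans (+-congˡ (sumMap-*ʳ f x xs)) (≈-sym (distribʳ x (f y) _))

  sumMap-+ : ∀ (f g : A → Carrier) xs → sumMap (λ x → f x +ᴿ g x) xs ≈ sumMap f xs +ᴿ sumMap g xs
  sumMap-+ f g []       = ≈-sym (+-identityˡ 0#)
  sumMap-+ f g (x ∷ xs) = ≈-trans (+-congˡ (sumMap-+ f g xs)) (interchange _ _ _ _)

  sumMap-zero : ∀ (xs : List A) → sumMap (λ _ → 0#) xs ≈ 0#
  sumMap-zero []       = ≈-refl
  sumMap-zero (x ∷ xs) = ≈-trans (+-identityˡ _) (sumMap-zero xs)

  sumMap-comm : ∀ (h : A → B → Carrier) xs ys →
                sumMap (λ x → sumMap (h x) ys) xs ≈ sumMap (λ y → sumMap (λ x → h x y) xs) ys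
  sumMap-comm h []       ys = ≈-sym (sumMap-zero ys)
  sumMap-comm h (x ∷ xs) ys = ≈-trans (+-congˡ (sumMap-comm h xs ys)) (≈-sym (sumMap-+ (h x) _ ys))

  sumMap-++ : ∀ (f : A → Carrier) xs ys → sumMap f (xs ++ ys) ≈ sumMap f xs +ᴿ sumMap f ys
  sumMap-++ f []       ys = ≈-sym (+-identityˡ _)
  sumMap-++ f (x ∷ xs) ys = ≈-trans (+-congˡ (sumMap-++ f xs ys)) (≈-sym (+-assoc _ _ _))

  sumMap-concatMap : ∀ (f : B → Carrier) (g : A → List B) xs →
                     sumMap f (concatMap g xs) ≈ sumMap (λ x → sumMap f (g x)) xs
  sumMap-concatMap f g []       = ≈-refl
  sumMap-concatMap f g (x ∷ xs) = ≈-trans (sumMap-++ f (g x) _) (+-congˡ (sumMap-concatMap f g xs))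

  sumMap-filter : ∀ {ℓ′} {P : Pred A ℓ′} (P? : Decidable P) (f : A → Carrier) xs →
                  sumMap f (filter P? xs) ≈ sumMap (λ x → if does (P? x) then f x else 0#) xs
  sumMap-filter P? f []       = ≈-refl
  sumMap-filter P? f (x ∷ xs) with does (P? x)
  ... | true  = +-congˡ (sumMap-filter P? f xs)
  ... | false = ≈-trans (sumMap-filter P? f xs) (≈-sym (+-identityˡ _))

  sumMap-allVecs-suc : ∀ q n (f : Vec (Fin q) (suc n) → Carrier) →
    sumMap f (allVecs q (suc n)) ≈ sumMap (λ v → sumMap (λ g → f (g ∷ v)) (allFin q)) (allVecs q n)
  sumMap-allVecs-suc q n f =
    ≈-trans (sumMap-concatMap f (λ v → List.map (λ g → g ∷ v) (allFin q)) (allVecs q n))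
            (sumMap-cong-≗ (allVecs q n) λ v → reflexive (cong (sumR R) (sym (map-∘ (allFin q)))))

  sumMap-allVecs-swapAt : ∀ q (i : Fin n) (f : Vec (Fin q) (suc n) → Carrier) →
                          sumMap (f ∘ swapAt i) (allVecs q (suc n)) ≈ sumMap f (allVecs q (suc n))
  sumMap-allVecs-swapAt {suc n} q zero f = begin
    sumMap (f ∘ swapAt zero) (allVecs q (suc (suc n)))
      ≈⟨ ≈-trans (sumMap-allVecs-suc q (suc n) _) (sumMap-allVecs-suc q n _) ⟩
    sumMap (λ v → sumMap (λ h → sumMap (λ g → f (h ∷ g ∷ v)) (allFin q)) (allFin q)) (allVecs q n)
      ≈⟨ sumMap-cong-≗ (allVecs q n) (λ v → sumMap-comm (λ h g → f (h ∷ g ∷ v)) (allFin q) (allFin q)) ⟩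
    sumMap (λ v → sumMap (λ g → sumMap (λ h → f (h ∷ g ∷ v)) (allFin q)) (allFin q)) (allVecs q n)
      ≈⟨ ≈-trans (sumMap-allVecs-suc q (suc n) _) (sumMap-allVecs-suc q n _) ⟨
    sumMap f (allVecs q (suc (suc n))) ∎
  sumMap-allVecs-swapAt {suc n} q (suc i) f = begin
    sumMap (f ∘ swapAt (suc i)) (allVecs q (suc (suc n)))
      ≈⟨ sumMap-allVecs-suc q (suc n) _ ⟩
    sumMap ((λ v → sumMap (λ g → f (g ∷ v)) (allFin q)) ∘ swapAt i) (allVecs q (suc n))
      ≈⟨ sumMap-allVecs-swapAt q i _ ⟩
    sumMap (λ v → sumMap (λ g → f (g ∷ v)) (allFin q)) (allVecs q (suc n))
      ≈⟨ sumMap-allVecs-suc q (suc n) f ⟨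
    sumMap f (allVecs q (suc (suc n))) ∎

  -- Σ_{comp y = r} ζ^{a·y}; K is the case r = (m,…,m), n = qm.
  compositionSum : Carrier → Vec ℕ q → Vec (Fin q) n → Carrier
  compositionSum {q} {n} ζ r a =
    sumMap (λ y → ζ ^ dot a y) (filter (λ y → ≡-dec ℕ._≟_ (comp y) r) (allVecs q n))

  compositionSum-swapAt : ∀ ζ (r : Vec ℕ q) (i : Fin n) a →
                          compositionSum ζ r (swapAt i a) ≈ compositionSum ζ r a
  compositionSum-swapAt {q} {n} ζ r i a = begin
    compositionSum ζ r (swapAt i a)                    ≈⟨ sumMap-filter inClass? _ (allVecs q (suc n)) ⟩
    sumMap (term (swapAt i a)) (allVecs q (suc n))     ≈⟨ sumMap-cong-≗ (allVecs q (suc n)) moved ⟩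
    sumMap (term a ∘ swapAt i) (allVecs q (suc n))     ≈⟨ sumMap-allVecs-swapAt q i (term a) ⟩
    sumMap (term a) (allVecs q (suc n))                ≈⟨ sumMap-filter inClass? _ (allVecs q (suc n)) ⟨
    compositionSum ζ r a                               ∎
    where
    inClass? : Decidable (λ (y : Vec (Fin q) (suc n)) → comp y ≡ r)
    inClass? y = ≡-dec ℕ._≟_ (comp y) r
    term : Vec (Fin q) (suc n) → Vec (Fin q) (suc n) → Carrier
    term b y = if does (inClass? y) then ζ ^ dot b y else 0#
    moved : ∀ y → term (swapAt i a) y ≈ term a (swapAt i y)
    moved y = reflexive (cong₂ (λ s e → if does (≡-dec ℕ._≟_ s r) then ζ ^ e else 0#)
                               (sym (comp-swapAt i y)) (dot-swapAt i a y))

  compositionSum-↭ : ∀ ζ (r : Vec ℕ q) {a b : Vec (Fin q) n} → a ↭ b →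
                     compositionSum ζ r a ≈ compositionSum ζ r b
  compositionSum-↭ ζ r = ↭-preserves {_≈_ = _≈_} (compositionSum ζ r) ≈-refl ≈-trans λ where
    (swapped i v) → ≈-sym (compositionSum-swapAt ζ r i v)

  K-map-cyclicPred : NoZeroDivisors R → ∀ {ζ} p m → PrimitiveRoot R (suc p) ζ →
                     (a : Vec (Fin (suc p)) (suc p * m)) →
                     K R ζ (suc p) m a ≈ K R ζ (suc p) m (Vec.map cyclicPred a) *ᴿ sign R (p * m)
  K-map-cyclicPred nzd {ζ} p m root a =
    ≈-trans (sumMap-cong (All.map shift (all-filter balanced? (allVecs (suc p) (suc p * m)))))
            (sumMap-*ʳ (λ y → ζ ^ dot a′ y) (sign R (p * m)) (balanced (suc p) m))
    where
    a′ : Vec (Fin (suc p)) (suc p * m)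
    a′ = Vec.map cyclicPred a
    balanced? : Decidable (λ (y : Vec (Fin (suc p)) (suc p * m)) → comp y ≡ tabulate (λ _ → m))
    balanced? y = ≡-dec ℕ._≟_ (comp y) (tabulate (λ _ → m))
    shift : ∀ {y} → comp y ≡ tabulate (λ _ → m) → ζ ^ dot a y ≈ ζ ^ dot a′ y *ᴿ sign R (p * m)
    shift {y} y-balanced with e , eq ← dot-map-cyclicPred a y = begin
      ζ ^ dot a y                                     ≈⟨ ^-periodic (suc p) (proj₁ root) (dot a y) e ⟨
      ζ ^ (dot a y + suc p * e)                       ≡⟨ cong (ζ ^_) eq ⟨
      ζ ^ (dot a′ y + Vec.sum (Vec.map toℕ y))        ≈⟨ ^-homo-* ζ (dot a′ y) _ ⟩
      ζ ^ dot a′ y *ᴿ ζ ^ Vec.sum (Vec.map toℕ y)     ≡⟨ cong (λ t → ζ ^ dot a′ y *ᴿ ζ ^ t) (sum-toℕ-balanced y y-balanced) ⟩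
      ζ ^ dot a′ y *ᴿ ζ ^ (triangle (suc p) * m)      ≈⟨ *-congˡ (^-assocʳ ζ (triangle (suc p)) m) ⟨
      ζ ^ dot a′ y *ᴿ (ζ ^ triangle (suc p)) ^ m      ≈⟨ *-congˡ (^-congˡ m (primitiveRoot-^triangle nzd (suc p) root)) ⟩
      ζ ^ dot a′ y *ᴿ sign R p ^ m                    ≈⟨ *-congˡ (^-assocʳ (- 1#) p m) ⟩
      ζ ^ dot a′ y *ᴿ sign R (p * m)                  ∎

lemma4p3 : ∀ {c ℓ : Level} (R : CommutativeRing c ℓ) →
           NoZeroDivisors R → (ζ : CommutativeRing.Carrier R) →
           (q m : ℕ) → 2 ≤ q → 1 ≤ m → PrimitiveRoot R q ζ →
           (a a′ : Vec (Fin q) (q * m)) → comp a′ ≡ rotate (comp a) →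
           CommutativeRing._≈_ R (K R ζ q m a′)
             (CommutativeRing._*_ R (sign R ((q ∸ 1) * m)) (K R ζ q m a))
lemma4p3 R nzd ζ zero    m ()
lemma4p3 R nzd ζ (suc p) m _ _ root a a′ a′-rotated = begin
  Kₘ a′                   ≈⟨ compositionSum-↭ R ζ _ (rotate-comp⇒↭ a a′ a′-rotated) ⟨
  Kₘ a↓                   ≈⟨ *-identityʳ _ ⟨
  Kₘ a↓ *ᴿ 1#             ≈⟨ *-congˡ (sign-*-self R (p * m)) ⟨
  Kₘ a↓ *ᴿ (s *ᴿ s)       ≈⟨ *-assoc _ s s ⟨
  Kₘ a↓ *ᴿ s *ᴿ s         ≈⟨ *-congʳ (K-map-cyclicPred R nzd p m root a) ⟨
  Kₘ a *ᴿ s               ≈⟨ *-comm _ s ⟩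
  s *ᴿ Kₘ a               ∎
  where
  open CommutativeRing R
    using (Carrier; setoid; 1#; *-identityʳ; *-congˡ; *-congʳ; *-assoc; *-comm) renaming (_*_ to _*ᴿ_)
  open import Relation.Binary.Reasoning.Setoid setoid
  Kₘ : Vec (Fin (suc p)) (suc p * m) → Carrier
  Kₘ = K R ζ (suc p) m
  a↓ : Vec (Fin (suc p)) (suc p * m)
  a↓ = Vec.map cyclicPred a
  s : Carrier
  s = sign R (p * m)
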